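{- Let $\mathbf A=(A,\land,\lor,{}',0,1)$ be an sp-orthomodular lattice and $\mathrm{Sh}(\mathbf A)=\{x\in A: x\land x'=0\}$. Then $(\mathrm{Sh}(\mathbf A),\leq,{}',0,1)$, with the order and involution inherited from $\mathbf A$, is a sub-orthomodular poset of $\mathbf A$.
   Context: A pseudo-Kleene lattice is a bounded lattice with antitone involution ${}'$ satisfying $x\land x'\leq y\lor y'$; it is sp-orthomodular if for all $x,y$: (SP1) $x\leq y$ and $x'\land y=(x\land x')\lor(y\land y')$ imply $y\land(x\lor x')=x\lor(y\land y')$; (SP2) $x\leq y$ implies $(x\land x')\lor(y\land y')=(x'\land y)\land(x'\land y)'$. An orthomodular poset is a bounded poset with antitone involution $(P,\leq,{}',0,1)$ such that whenever $x\leq y'$ the supremum $x\lor y$ exists in $P$, the infimum of $x$ and $x'$ is $0$ for every $x$, and it is paraorthomodular: $x\leq y$ and $x'\land y=0$ (infimum in $P$) imply $x=y$. For $B\subseteq A$ containing $0,1$ and closed under ${}'$, $(B,\leq,{}',0,1)$ is a sub-orthomodular poset of $\mathbf A$ if it is an orthomodular poset and, for all $x,y\in B$ with $x\leq y'$, the supremum of $x,y$ in $B$ equals $x\lor y$ computed in $\mathbf A$. -}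

module Defs where

open import Level using (Level; _⊔_) renaming (suc to lsuc)
open import Data.Product using (_×_; Σ)
open import Relation.Unary using (Pred; _∈_)
open import Relation.Binary.Lattice.Bundles using (BoundedLattice)

record PseudoKleeneLattice (c ℓ₁ ℓ₂ : Level) : Set (lsuc (c ⊔ ℓ₁ ⊔ ℓ₂)) where
  field
    boundedLattice : BoundedLattice c ℓ₁ ℓ₂
  open BoundedLattice boundedLattice public
  infix 8 _′
  field
    _′        : Carrier → Carrier
    ′-cong    : ∀ {x y} → x ≈ y → x ′ ≈ y ′
    ′-antitone : ∀ {x y} → x ≤ y → y ′ ≤ x ′
    ′-involutive : ∀ x → (x ′) ′ ≈ x
    kleene    : ∀ x y → x ∧ x ′ ≤ y ∨ y ′

record IsSpOrthomodular {c ℓ₁ ℓ₂} (A : PseudoKleeneLattice c ℓ₁ ℓ₂) : Set (c ⊔ ℓ₁ ⊔ ℓ₂) where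
  open PseudoKleeneLattice A
  field
    SP1 : ∀ x y → x ≤ y → x ′ ∧ y ≈ (x ∧ x ′) ∨ (y ∧ y ′) →
          y ∧ (x ∨ x ′) ≈ x ∨ (y ∧ y ′)
    SP2 : ∀ x y → x ≤ y →
          (x ∧ x ′) ∨ (y ∧ y ′) ≈ (x ′ ∧ y) ∧ (x ′ ∧ y) ′

record SpOrthomodularLattice (c ℓ₁ ℓ₂ : Level) : Set (lsuc (c ⊔ ℓ₁ ⊔ ℓ₂)) where
  field
    pkl : PseudoKleeneLattice c ℓ₁ ℓ₂
    isSpOrthomodular : IsSpOrthomodular pkl
  open PseudoKleeneLattice pkl public

module _ {c ℓ₁ ℓ₂} (A : PseudoKleeneLattice c ℓ₁ ℓ₂) where
  open PseudoKleeneLattice A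

  Sh : Pred Carrier ℓ₁
  Sh x = x ∧ x ′ ≈ ⊥

  module _ {ℓ} (B : Pred Carrier ℓ) where

    IsSupIn : Carrier → Carrier → Carrier → Set (c ⊔ ℓ ⊔ ℓ₂)
    IsSupIn x y s = s ∈ B × x ≤ s × y ≤ s ×
                    (∀ z → z ∈ B → x ≤ z → y ≤ z → s ≤ z)

    IsInfIn : Carrier → Carrier → Carrier → Set (c ⊔ ℓ ⊔ ℓ₂)
    IsInfIn x y i = i ∈ B × i ≤ x × i ≤ y ×
                    (∀ z → z ∈ B → z ≤ x → z ≤ y → z ≤ i)

    -- (B, ≤, ′, 0, 1) with the order and involution inherited from A is an
    -- orthomodular poset (B contains 0, 1 and is closed under ′, so it is a
    -- bounded poset with antitone involution).
    record IsOrthomodularSubposet : Set (c ⊔ ℓ ⊔ ℓ₁ ⊔ ℓ₂) where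
      field
        ⊥∈ : ⊥ ∈ B
        ⊤∈ : ⊤ ∈ B
        ′-closed : ∀ x → x ∈ B → x ′ ∈ B
        sup-exists : ∀ x y → x ∈ B → y ∈ B → x ≤ y ′ → Σ Carrier (IsSupIn x y)
        inf-compl : ∀ x → x ∈ B → IsInfIn x (x ′) ⊥
        paraorthomodular : ∀ x y → x ∈ B → y ∈ B → x ≤ y →
                           IsInfIn (x ′) y ⊥ → x ≈ y

    record IsSubOrthomodularPoset : Set (c ⊔ ℓ ⊔ ℓ₁ ⊔ ℓ₂) where
      field
        isOrthomodularSubposet : IsOrthomodularSubposet
        sup-agrees : ∀ x y → x ∈ B → y ∈ B → x ≤ y ′ → IsSupIn x y (x ∨ y)

{-# OPTIONS --safe #-}
module Submission where

-- For sharp x ≤ y, (SP2) makes the relative complement x′ ∧ y sharp. Applied to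
-- x ≤ y′ and combined with De Morgan, (x′ ∧ y′)′ = x ∨ y, this shows that the
-- lattice join of orthogonal sharp elements is sharp, hence is their supremum in
-- Sh. Likewise the infimum of x′ and y in Sh is x′ ∧ y itself; when it is 0 the
-- premise of (SP1) holds, and its conclusion collapses to y = x because
-- x ∨ x′ = 1 for sharp x.

open import Defs
open import Level using (Level)
open import Data.Product using (_,_)
import Relation.Binary.Lattice.Properties.BoundedJoinSemilattice as BoundedJoinProperties
import Relation.Binary.Lattice.Properties.BoundedMeetSemilattice as BoundedMeetProperties
import Relation.Binary.Lattice.Properties.JoinSemilattice as JoinProperties
import Relation.Binary.Lattice.Properties.MeetSemilattice as MeetProperties
import Relation.Binary.Reasoning.PartialOrder as ≤-Reasoning
import Relation.Binary.Reasoning.Setoid as ≈-Reasoning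

module PseudoKleeneLatticeProperties {c ℓ₁ ℓ₂} (A : PseudoKleeneLattice c ℓ₁ ℓ₂) where
  open PseudoKleeneLattice A
  open JoinProperties joinSemilattice public using (∨-cong; ∨-idempotent)
  open MeetProperties meetSemilattice public using (∧-cong; ∧-comm)
  open BoundedJoinProperties boundedJoinSemilattice public
    using () renaming (identityʳ to ∨-identityʳ)
  open BoundedMeetProperties boundedMeetSemilattice public
    using () renaming (identityʳ to ∧-identityʳ)

  x≤⊥⇒x≈⊥ : ∀ {x} → x ≤ ⊥ → x ≈ ⊥
  x≤⊥⇒x≈⊥ x≤⊥ = antisym x≤⊥ (minimum _)

  x≤y′⇒y≤x′ : ∀ {x y} → x ≤ y ′ → y ≤ x ′
  x≤y′⇒y≤x′ {x} {y} x≤y′ = begin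
    y       ≈⟨ Eq.sym (′-involutive y) ⟩
    y ′ ′   ≤⟨ ′-antitone x≤y′ ⟩
    x ′     ∎
    where open ≤-Reasoning poset

  ′-∨ : ∀ x y → (x ∨ y) ′ ≈ x ′ ∧ y ′
  ′-∨ x y = antisym
    (∧-greatest (′-antitone (x≤x∨y x y)) (′-antitone (y≤x∨y x y)))
    (x≤y′⇒y≤x′ (∨-least (x≤y′⇒y≤x′ (x∧y≤x (x ′) (y ′)))
                        (x≤y′⇒y≤x′ (x∧y≤y (x ′) (y ′)))))

  ′-∧′ : ∀ x y → (x ′ ∧ y ′) ′ ≈ x ∨ y
  ′-∧′ x y = Eq.trans (′-cong (Eq.sym (′-∨ x y))) (′-involutive (x ∨ y))

  ⊥′≈⊤ : ⊥ ′ ≈ ⊤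
  ⊥′≈⊤ = antisym (maximum (⊥ ′)) (x≤y′⇒y≤x′ (minimum (⊤ ′)))

  Sh-resp-≈ : ∀ {x y} → x ≈ y → Sh A x → Sh A y
  Sh-resp-≈ x≈y x∈Sh = Eq.trans (∧-cong (Eq.sym x≈y) (′-cong (Eq.sym x≈y))) x∈Sh

  Sh-⊥ : Sh A ⊥
  Sh-⊥ = x≤⊥⇒x≈⊥ (x∧y≤x ⊥ (⊥ ′))

  Sh-′ : ∀ {x} → Sh A x → Sh A (x ′)
  Sh-′ {x} x∈Sh = Eq.trans (∧-cong Eq.refl (′-involutive x)) (Eq.trans (∧-comm (x ′) x) x∈Sh)

  Sh-⊤ : Sh A ⊤
  Sh-⊤ = Sh-resp-≈ ⊥′≈⊤ (Sh-′ Sh-⊥)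

  Sh⇒x∨x′≈⊤ : ∀ {x} → Sh A x → x ∨ x ′ ≈ ⊤
  Sh⇒x∨x′≈⊤ {x} x∈Sh = begin
    x ∨ x ′              ≈⟨ Eq.sym (′-involutive (x ∨ x ′)) ⟩
    (x ∨ x ′) ′ ′        ≈⟨ ′-cong (′-∨ x (x ′)) ⟩
    (x ′ ∧ x ′ ′) ′      ≈⟨ ′-cong (Sh-′ x∈Sh) ⟩
    ⊥ ′                  ≈⟨ ⊥′≈⊤ ⟩
    ⊤                    ∎
    where open ≈-Reasoning setoid

  Sh²⇒x∧x′∨y∧y′≈⊥ : ∀ {x y} → Sh A x → Sh A y → (x ∧ x ′) ∨ (y ∧ y ′) ≈ ⊥
  Sh²⇒x∧x′∨y∧y′≈⊥ x∈Sh y∈Sh = Eq.trans (∨-cong x∈Sh y∈Sh) (∨-idempotent ⊥)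

  ∨-isSupIn-Sh : ∀ {x y} → Sh A (x ∨ y) → IsSupIn A (Sh A) x y (x ∨ y)
  ∨-isSupIn-Sh {x} {y} x∨y∈Sh = x∨y∈Sh , x≤x∨y x y , y≤x∨y x y , λ _ _ → ∨-least

  ⊥-isInfIn-Sh : ∀ {x} → Sh A x → IsInfIn A (Sh A) x (x ′) ⊥
  ⊥-isInfIn-Sh {x} x∈Sh = Sh-⊥ , minimum x , minimum (x ′) ,
    λ _ _ z≤x z≤x′ → trans (∧-greatest z≤x z≤x′) (reflexive x∈Sh)

module SpOrthomodularLatticeProperties {c ℓ₁ ℓ₂} (A : SpOrthomodularLattice c ℓ₁ ℓ₂) where
  open SpOrthomodularLattice A
  open IsSpOrthomodular isSpOrthomodular
  open PseudoKleeneLatticeProperties pkl public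

  Sh-′∧ : ∀ {x y} → Sh pkl x → Sh pkl y → x ≤ y → Sh pkl (x ′ ∧ y)
  Sh-′∧ {x} {y} x∈Sh y∈Sh x≤y =
    Eq.trans (Eq.sym (SP2 x y x≤y)) (Sh²⇒x∧x′∨y∧y′≈⊥ x∈Sh y∈Sh)

  Sh-∨ : ∀ {x y} → Sh pkl x → Sh pkl y → x ≤ y ′ → Sh pkl (x ∨ y)
  Sh-∨ {x} {y} x∈Sh y∈Sh x≤y′ =
    Sh-resp-≈ (′-∧′ x y) (Sh-′ (Sh-′∧ x∈Sh (Sh-′ y∈Sh) x≤y′))

  Sh-∨-isSupIn : ∀ {x y} → Sh pkl x → Sh pkl y → x ≤ y ′ →
                 IsSupIn pkl (Sh pkl) x y (x ∨ y)
  Sh-∨-isSupIn x∈Sh y∈Sh x≤y′ = ∨-isSupIn-Sh (Sh-∨ x∈Sh y∈Sh x≤y′)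

  Sh-paraorthomodular : ∀ {x y} → Sh pkl x → Sh pkl y → x ≤ y → x ′ ∧ y ≈ ⊥ → x ≈ y
  Sh-paraorthomodular {x} {y} x∈Sh y∈Sh x≤y x′∧y≈⊥ = begin
    x                   ≈⟨ Eq.sym (∨-identityʳ x) ⟩
    x ∨ ⊥               ≈⟨ ∨-cong Eq.refl (Eq.sym y∈Sh) ⟩
    x ∨ (y ∧ y ′)       ≈⟨ Eq.sym (SP1 x y x≤y x′∧y≈defects) ⟩
    y ∧ (x ∨ x ′)       ≈⟨ ∧-cong Eq.refl (Sh⇒x∨x′≈⊤ x∈Sh) ⟩
    y ∧ ⊤               ≈⟨ ∧-identityʳ y ⟩
    y                   ∎
    where
    open ≈-Reasoning setoid
    x′∧y≈defects : x ′ ∧ y ≈ (x ∧ x ′) ∨ (y ∧ y ′)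
    x′∧y≈defects = Eq.trans x′∧y≈⊥ (Eq.sym (Sh²⇒x∧x′∨y∧y′≈⊥ x∈Sh y∈Sh))

  Sh-isInfIn⇒≈ : ∀ {x y} → Sh pkl x → Sh pkl y → x ≤ y →
                 IsInfIn pkl (Sh pkl) (x ′) y ⊥ → x ≈ y
  Sh-isInfIn⇒≈ {x} {y} x∈Sh y∈Sh x≤y (_ , _ , _ , greatest) =
    Sh-paraorthomodular x∈Sh y∈Sh x≤y
      (x≤⊥⇒x≈⊥ (greatest (x ′ ∧ y) (Sh-′∧ x∈Sh y∈Sh x≤y) (x∧y≤x (x ′) y) (x∧y≤y (x ′) y)))

lemma3p18 : ∀ {c ℓ₁ ℓ₂ : Level} (A : SpOrthomodularLattice c ℓ₁ ℓ₂) →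
              IsSubOrthomodularPoset (SpOrthomodularLattice.pkl A)
                (Sh (SpOrthomodularLattice.pkl A))
lemma3p18 A = record
  { isOrthomodularSubposet = record
    { ⊥∈               = Sh-⊥
    ; ⊤∈               = Sh-⊤
    ; ′-closed         = λ _ → Sh-′
    ; sup-exists       = λ x y x∈Sh y∈Sh x≤y′ → x ∨ y , Sh-∨-isSupIn x∈Sh y∈Sh x≤y′
    ; inf-compl        = λ _ → ⊥-isInfIn-Sh
    ; paraorthomodular = λ _ _ → Sh-isInfIn⇒≈
    }
  ; sup-agrees = λ _ _ → Sh-∨-isSupIn
  }
  where
  open SpOrthomodularLattice A using (_∨_)
  open SpOrthomodularLatticeProperties A
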